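{- Let $\mathcal{G}$ be a finite connected graph whose vertices carry positive populations, let $k\ge1$ be an integer, let $\epsilon>0$, and let $\mathcal{I}=\mathrm{pop}(\mathcal{G})/k$. Run the Bonsai algorithm described below with tolerance multiplier function $\phi(n)=n$ and with a rule for choosing the "best" triple that, whenever it is applied, selects each currently recorded valid triple with positive probability. Then every valid plan for $(\mathcal{G},k,\epsilon)$ is output by the algorithm with positive probability.
   Context: $\mathrm{pop}$ of a vertex set or subgraph is the sum of the populations of its vertices. A valid plan is a partition of $V(\mathcal{G})$ into $k$ sets $D_1,\dots,D_k$, each inducing a connected subgraph, with $(1-\epsilon)\mathcal{I}<\mathrm{pop}(D_i)<(1+\epsilon)\mathcal{I}$ for every $i$. Given a tolerance multiplier function $\phi:\mathbb{N}\to[1,\infty)$ with $1\le\phi(n)\le n$, a connected subgraph $H$ with spanning tree $T$ and an integer $m\ge 2$, a triple $(e,k_1,k_2)$ is valid if $e$ is an edge of $T$, $k_1,k_2$ are positive integers with $k_1+k_2=m$, and, writing $H_1,H_2$ for the subgraphs of $H$ induced by the vertex sets of the two components of $T-e$ (with a specified labeling), one has $\delta_i:=|\mathrm{pop}(H_i)-k_i\mathcal{I}|/\mathcal{I}\le \phi(k_i)\epsilon$ for $i=1,2$. The Bonsai algorithm: draw a uniformly random spanning tree $T$ of $\mathcal{G}$ and return GeneratePlan$(\mathcal{G},T,k)$, where GeneratePlan$(H,T,m)$ is: if $m=1$, return $\{H\}$; otherwise repeat: record all valid triples for $(H,T,m)$; if there are none, replace $T$ by a fresh uniformly random spanning tree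 of $H$ and repeat; otherwise choose one recorded triple $(e,k_1,k_2)$ (by the given "best"-triple rule), remove $e$ from $T$, let $H_1,H_2$ be the resulting induced subgraphs with induced spanning trees $T_1,T_2$, and return GeneratePlan$(H_1,T_1,k_1)\cup$ GeneratePlan$(H_2,T_2,k_2)$.
   Formalization: The vertex populations and the tolerance $\epsilon$ take values in the rationals. -}

module Defs where

open import Data.Bool using (Bool; true; false; _∧_; if_then_else_; not)
open import Data.Nat as ℕ using (ℕ; zero; suc; _≥_)
open import Data.Fin using (Fin; zero; suc; _≟_)
open import Data.Fin.Subset using (Subset; _∈_; Nonempty; ⊤) renaming (∣_∣ to #_)
open import Data.Vec using (Vec; []; _∷_; lookup)
open import Data.List using (List; []; _∷_; [_]; _++_; length; filterᵇ)
open import Data.List.Membership.Propositional using () renaming (_∈_ to _∈ₗ_)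
open import Data.List.Relation.Unary.Any using (Any)
open import Data.List.Relation.Unary.All using (All)
open import Data.List.Relation.Unary.AllPairs using (AllPairs)
open import Data.List.Relation.Unary.Unique.Propositional using (Unique)
open import Data.List.Relation.Binary.Permutation.Propositional using (_↭_)
open import Data.Product using (Σ; ∃; _×_; _,_; proj₁; proj₂)
open import Data.Product.Properties using (≡-dec)
open import Data.Sum using (_⊎_)
open import Data.Integer using (+_)
open import Data.Rational using (ℚ; 0ℚ; 1ℚ; _+_; _-_; _*_; _/_; _<_; _≤_; ∣_∣)
open import Relation.Nullary using (¬_; does)
open import Relation.Binary.PropositionalEquality using (_≡_)

-- Graph on vertex set Fin n; an (undirected) edge is an ordered pair of vertices,
-- read without orientation.
Edge : ℕ → Set
Edge n = Fin n × Fin n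

ℕ→ℚ : ℕ → ℚ
ℕ→ℚ m = + m / 1

popS : {n : ℕ} → (Fin n → ℚ) → Subset n → ℚ
popS {zero} p [] = 0ℚ
popS {suc n} p (b ∷ s) = (if b then p zero else 0ℚ) + popS (λ i → p (suc i)) s

restrict : {n : ℕ} → List (Edge n) → Subset n → List (Edge n)
restrict F S = filterᵇ (λ e → lookup S (proj₁ e) ∧ lookup S (proj₂ e)) F

removeEdge : {n : ℕ} → List (Edge n) → Edge n → List (Edge n)
removeEdge F e = filterᵇ (λ f → not (does (≡-dec _≟_ _≟_ f e))) F

data Path {n : ℕ} (F : List (Edge n)) : Fin n → Fin n → Set where
  here : ∀ {u} → Path F u u
  stepF : ∀ {u w v} → (u , w) ∈ₗ F → Path F w v → Path F u v
  stepB : ∀ {u w v} → (w , u) ∈ₗ F → Path F w v → Path F u v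

Connected : {n : ℕ} → List (Edge n) → Subset n → Set
Connected F S = ∀ u v → u ∈ S → v ∈ S → Path (restrict F S) u v

IsSpanningTree : {n : ℕ} → List (Edge n) → Subset n → List (Edge n) → Set
IsSpanningTree E S T =
  All (_∈ₗ restrict E S) T × Unique T × Connected T S × (ℕ.suc (length T) ≡ # S)

-- S₁, S₂ are the vertex sets of the two components of T - e (T a spanning tree of G[S])
Components : {n : ℕ} → List (Edge n) → Edge n → Subset n → Subset n → Subset n → Set
Components {n} T e S S₁ S₂ =
  (∀ (v : Fin n) → (v ∈ S → v ∈ S₁ ⊎ v ∈ S₂) × (v ∈ S₁ → v ∈ S) × (v ∈ S₂ → v ∈ S)
                   × ¬ (v ∈ S₁ × v ∈ S₂))
  × Connected (removeEdge T e) S₁ × Connected (removeEdge T e) S₂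

-- valid triple (e, k₁, k₂) for (H = G[S], T, m), with φ(n) = n, and with
-- H₁ = G[S₁], H₂ = G[S₂] the (labelled) components.  Condition
-- δᵢ = |pop(Hᵢ) - kᵢ I| / I ≤ φ(kᵢ) ε is written multiplied through by I > 0.
record ValidTriple {n : ℕ} (pop : Fin n → ℚ) (I ε : ℚ)
                   (S : Subset n) (T : List (Edge n)) (m : ℕ)
                   (e : Edge n) (k₁ k₂ : ℕ) (S₁ S₂ : Subset n) : Set where
  field
    e∈T   : e ∈ₗ T
    k₁≥1  : k₁ ≥ 1
    k₂≥1  : k₂ ≥ 1
    sum   : k₁ ℕ.+ k₂ ≡ m
    comps : Components T e S S₁ S₂
    tol₁  : ∣ popS pop S₁ - ℕ→ℚ k₁ * I ∣ ≤ (ℕ→ℚ k₁ * ε) * I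
    tol₂  : ∣ popS pop S₂ - ℕ→ℚ k₂ * I ∣ ≤ (ℕ→ℚ k₂ * ε) * I

NoValidTriple : {n : ℕ} (pop : Fin n → ℚ) (I ε : ℚ)
                (S : Subset n) (T : List (Edge n)) (m : ℕ) → Set
NoValidTriple pop I ε S T m =
  ∀ e k₁ k₂ S₁ S₂ → ¬ ValidTriple pop I ε S T m e k₁ k₂ S₁ S₂

-- GenPlan E pop I ε S T m P : the list P (of vertex sets) is a possible output of
-- GeneratePlan(G[S], T, m) along some finite run of the algorithm in which every
-- random choice (spanning tree drawn, triple selected) is one of positive probability.
data GenPlan {n : ℕ} (E : List (Edge n)) (pop : Fin n → ℚ) (I ε : ℚ)
     : Subset n → List (Edge n) → ℕ → List (Subset n) → Set where
  base : ∀ {S T} → GenPlan E pop I ε S T 1 [ S ]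
  resample : ∀ {S T T′ m P} → m ≥ 2 → NoValidTriple pop I ε S T m →
             IsSpanningTree E S T′ → GenPlan E pop I ε S T′ m P →
             GenPlan E pop I ε S T m P
  split : ∀ {S T m e k₁ k₂ S₁ S₂ P₁ P₂} → m ≥ 2 →
          ValidTriple pop I ε S T m e k₁ k₂ S₁ S₂ →
          GenPlan E pop I ε S₁ (restrict (removeEdge T e) S₁) k₁ P₁ →
          GenPlan E pop I ε S₂ (restrict (removeEdge T e) S₂) k₂ P₂ →
          GenPlan E pop I ε S T m (P₁ ++ P₂)

ideal : {n : ℕ} → (Fin n → ℚ) → (k : ℕ) → .{{_ : ℕ.NonZero k}} → ℚ
ideal pop k = popS pop ⊤ * (+ 1 / k)

Disjoint : {n : ℕ} → Subset n → Subset n → Set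
Disjoint {n} A B = ∀ (v : Fin n) → ¬ (v ∈ A × v ∈ B)

ValidPlan : {n : ℕ} (E : List (Edge n)) (pop : Fin n → ℚ) (k : ℕ) .{{_ : ℕ.NonZero k}}
            (ε : ℚ) → List (Subset n) → Set
ValidPlan {n} E pop k ε P =
  length P ≡ k
  × AllPairs Disjoint P
  × (∀ (v : Fin n) → Any (v ∈_) P)
  × All (λ D → Nonempty D × Connected E D
               × ((1ℚ - ε) * ideal pop k < popS pop D)
               × (popS pop D < (1ℚ + ε) * ideal pop k)) P

-- the Bonsai algorithm outputs the plan P with positive probability:
-- some initial spanning tree of G and some run of GeneratePlan produce P
-- (up to the order of the districts).
BonsaiOutputs : {n : ℕ} (E : List (Edge n)) (pop : Fin n → ℚ) (k : ℕ) .{{_ : ℕ.NonZero k}}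
                (ε : ℚ) → List (Subset n) → Set
BonsaiOutputs {n} E pop k ε P =
  Σ (List (Edge n)) λ T → Σ (List (Subset n)) λ Q →
    IsSpanningTree E ⊤ T × GenPlan E pop (ideal pop k) ε ⊤ T k Q × (Q ↭ P)

-- Take a spanning tree of G made of spanning trees of the k districts plus k - 1 edges
-- joining them, grown greedily from one district so that the districts come in an order
-- D₁, …, Dₖ in which each Dᵢ is joined by a tree edge to Dᵢ₊₁ ∪ … ∪ Dₖ.  On the subgraph
-- Dᵢ ∪ … ∪ Dₖ of m districts, cutting that edge is a valid triple (e, 1, m - 1): Dᵢ meets
-- the tolerance for one district, and since φ(m) = m the condition |pop - m I| ≤ m ε I is
-- additive over disjoint unions, so Dᵢ₊₁ ∪ … ∪ Dₖ meets it for m - 1 districts.  Hence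
-- GeneratePlan can split off the districts one at a time, each choice having positive
-- probability.
{-# OPTIONS --safe #-}
module Submission where

open import Defs
import Data.Bool as Bool
open import Data.Bool using (_∧_; not)
open import Data.Bool.Properties using (T-≡; T-∧; T-not-≡)
open import Data.Empty using (⊥-elim)
open import Data.Unit using (tt) renaming (⊤ to 𝟙)
open import Data.Nat as ℕ using (ℕ; zero; suc; NonZero; z≤n; s≤s)
import Data.Nat.Properties as ℕ
open import Data.Integer as ℤ using (+_)
import Data.Integer.Properties as ℤ
open import Data.Fin using (Fin; zero; suc; _≟_)
open import Data.Fin.Properties using (any?)
open import Data.Fin.Subset
  using (Subset; ⊤; _∈_; _∉_; _∪_; _⊆_; ⁅_⁆; Nonempty; inside; outside)
  renaming (⊥ to ∅; ∣_∣ to #_)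
open import Data.Fin.Subset.Properties
  using (_∈?_; ∉⊥; ∈⊤; ⊆-antisym; ∪-identityʳ; x∈p∪q⁺; x∈p∪q⁻; p⊆p∪q; q⊆p∪q;
         x∈⁅x⁆; x∈⁅y⁆⇒x≡y; ∣⁅x⁆∣≡1; ∣p∣≤n)
open import Data.Vec using ([]; _∷_; lookup; here; there)
open import Data.Vec.Properties using ([]=⇒lookup; lookup⇒[]=)
open import Data.List using (List; []; _∷_; [_]; _++_; length)
open import Data.List.Properties using (length-++; ++-identityʳ)
open import Data.List.Membership.Propositional using () renaming (_∈_ to _∈ₗ_)
open import Data.List.Membership.Propositional.Properties
  using (∈-filter⁺; ∈-filter⁻; ∈-++⁻; ∈-++⁺ˡ; ∈-++⁺ʳ)
open import Data.List.Relation.Unary.Any using (Any; here; there)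
open import Data.List.Relation.Unary.Any.Properties using (++⁻)
open import Data.List.Relation.Unary.All as All using (All; []; _∷_)
import Data.List.Relation.Unary.All.Properties as All
open import Data.List.Relation.Unary.AllPairs using (AllPairs; []; _∷_)
import Data.List.Relation.Unary.Unique.Propositional.Properties as Unique
open import Data.List.Relation.Binary.Permutation.Propositional
  using (_↭_; ↭-refl; ↭-sym; ↭-trans; prep; swap)
open import Data.List.Relation.Binary.Permutation.Propositional.Properties
  using (All-resp-↭; Any-resp-↭; shift; ++⁺ˡ; ↭-length)
open import Data.Product using (∃; ∃₂; _×_; _,_; proj₁; proj₂)
import Data.Product as Product
open import Data.Product.Properties using (≡-dec)
open import Data.Sum using (_⊎_; inj₁; inj₂)
import Data.Sum as Sum
open import Data.Rational
  using (ℚ; 0ℚ; 1ℚ; Positive; toℚᵘ; _+_; _-_; _*_; -_; _<_; _≤_; ∣_∣)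
open import Data.Rational.Properties
  using (toℚᵘ-injective; toℚᵘ-fromℚᵘ; toℚᵘ-homo-+; ∣p∣≡p∨∣p∣≡-p; ∣p+q∣≤∣p∣+∣q∣;
         +-mono-≤; +-monoˡ-≤; +-monoʳ-≤; neg-antimono-≤; *-distribʳ-+; module ≤-Reasoning)
import Data.Rational.Unnormalised as ℚᵘ
import Data.Rational.Unnormalised.Properties as ℚᵘ
open import Data.Rational.Solver using (module +-*-Solver)
open import Function using (_∘_; _∘′_; Equivalence)
open import Relation.Nullary using (¬_; does; yes; no; ¬?)
open import Relation.Nullary.Decidable using (T?; dec-false; _×-dec_; decidable-stable)
open import Relation.Binary.Definitions using (Symmetric)
open import Relation.Binary.PropositionalEquality
  using (_≡_; _≢_; refl; sym; trans; cong; cong₂; subst; module ≡-Reasoning)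

private
  variable
    n : ℕ
    u v w : Fin n
    c e f : Edge n
    A B C D S U : Subset n
    F G T T′ : List (Edge n)
    L : List (Subset n)

Inside : Subset n → Edge n → Set
Inside S f = proj₁ f ∈ S × proj₂ f ∈ S

Cross : Subset n → Subset n → Edge n → Set
Cross A B f = (proj₁ f ∈ A × proj₂ f ∈ B) ⊎ (proj₁ f ∈ B × proj₂ f ∈ A)

Adjacent : List (Edge n) → Fin n → Fin n → Set
Adjacent F u w = (u , w) ∈ₗ F ⊎ (w , u) ∈ₗ F

inside-⊆ : A ⊆ B → Inside A f → Inside B f
inside-⊆ A⊆B = Product.map A⊆B A⊆B

cross⇒inside-∪ : Cross A B f → Inside (A ∪ B) f
cross⇒inside-∪ {A = A} {B} (inj₁ (u∈A , w∈B)) = p⊆p∪q B u∈A , q⊆p∪q A B w∈B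
cross⇒inside-∪ {A = A} {B} (inj₂ (u∈B , w∈A)) = q⊆p∪q A B u∈B , p⊆p∪q B w∈A

disjoint-sym : Disjoint A B → Disjoint B A
disjoint-sym A#B v (v∈B , v∈A) = A#B v (v∈A , v∈B)

disjoint-∪ : Disjoint A B → Disjoint A C → Disjoint A (B ∪ C)
disjoint-∪ {B = B} {C} A#B A#C v (v∈A , v∈B∪C) with x∈p∪q⁻ B C v∈B∪C
... | inj₁ v∈B = A#B v (v∈A , v∈B)
... | inj₂ v∈C = A#C v (v∈A , v∈C)

cross⇒¬insideˡ : Disjoint A B → Cross A B f → ¬ Inside A f
cross⇒¬insideˡ A#B (inj₁ (_ , w∈B)) (_ , w∈A) = A#B _ (w∈A , w∈B)
cross⇒¬insideˡ A#B (inj₂ (u∈B , _)) (u∈A , _) = A#B _ (u∈A , u∈B)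

cross⇒¬insideʳ : Disjoint A B → Cross A B f → ¬ Inside B f
cross⇒¬insideʳ A#B = cross⇒¬insideˡ (disjoint-sym A#B) ∘ Sum.swap

∈⇒T-lookup : v ∈ S → Bool.T (lookup S v)
∈⇒T-lookup = Equivalence.from T-≡ ∘ []=⇒lookup

T-lookup⇒∈ : Bool.T (lookup S v) → v ∈ S
T-lookup⇒∈ = lookup⇒[]= _ _ ∘ Equivalence.to T-≡

∈-restrict⁻ : f ∈ₗ restrict F S → f ∈ₗ F × Inside S f
∈-restrict⁻ {S = S} f∈ with ∈-filter⁻ (λ e → T? (lookup S (proj₁ e) ∧ lookup S (proj₂ e))) f∈
... | f∈F , both = f∈F , Product.map T-lookup⇒∈ T-lookup⇒∈ (Equivalence.to T-∧ both)

∈-restrict⁺ : f ∈ₗ F → Inside S f → f ∈ₗ restrict F S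
∈-restrict⁺ {S = S} f∈F (u∈S , w∈S) =
  ∈-filter⁺ (λ e → T? (lookup S (proj₁ e) ∧ lookup S (proj₂ e))) f∈F
    (Equivalence.from T-∧ (∈⇒T-lookup u∈S , ∈⇒T-lookup w∈S))

restrict-⊆ : A ⊆ B → f ∈ₗ restrict F A → f ∈ₗ restrict F B
restrict-⊆ {F = F} A⊆B f∈ with ∈-restrict⁻ {F = F} f∈
... | f∈F , f∈A = ∈-restrict⁺ f∈F (inside-⊆ A⊆B f∈A)

∈-removeEdge⁺ : f ∈ₗ F → f ≢ e → f ∈ₗ removeEdge F e
∈-removeEdge⁺ {f = f} {e = e} f∈F f≢e =
  ∈-filter⁺ (λ g → T? (not (does (≡-dec _≟_ _≟_ g e)))) f∈F
    (Equivalence.from T-not-≡ (dec-false (≡-dec _≟_ _≟_ f e) f≢e))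

∈-removeEdge-inside : ¬ Inside A e → f ∈ₗ F → Inside A f → f ∈ₗ removeEdge F e
∈-removeEdge-inside e∉A f∈F f∈A = ∈-removeEdge⁺ f∈F λ { refl → e∉A f∈A }

adjacent-restrict⁻ : Adjacent (restrict F S) u w → Adjacent F u w × w ∈ S
adjacent-restrict⁻ {F = F} (inj₁ e) = let e∈F , _ , w∈S = ∈-restrict⁻ {F = F} e in inj₁ e∈F , w∈S
adjacent-restrict⁻ {F = F} (inj₂ e) = let e∈F , w∈S , _ = ∈-restrict⁻ {F = F} e in inj₂ e∈F , w∈S

adjacent⇒cross : Adjacent F u w → u ∈ B → w ∈ A → ∃ λ c → c ∈ₗ F × Cross A B c
adjacent⇒cross (inj₁ e) u∈B w∈A = _ , e , inj₂ (u∈B , w∈A)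
adjacent⇒cross (inj₂ e) u∈B w∈A = _ , e , inj₁ (w∈A , u∈B)

path-mono : (∀ {f} → f ∈ₗ F → f ∈ₗ G) → Path F u v → Path G u v
path-mono F⊆G here = here
path-mono F⊆G (stepF e p) = stepF (F⊆G e) (path-mono F⊆G p)
path-mono F⊆G (stepB e p) = stepB (F⊆G e) (path-mono F⊆G p)

path-++ : Path F u v → Path F v w → Path F u w
path-++ here q = q
path-++ (stepF e p) q = stepF e (path-++ p q)
path-++ (stepB e p) q = stepB e (path-++ p q)

path-reverse : Path F u v → Path F v u
path-reverse here = here
path-reverse (stepF e p) = path-++ (path-reverse p) (stepB e here)
path-reverse (stepB e p) = path-++ (path-reverse p) (stepF e here)

path-exit : Path F u v → u ∈ S → v ∉ S → ∃₂ λ x y → x ∈ S × y ∉ S × Adjacent F x y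
path-exit here u∈S u∉S = ⊥-elim (u∉S u∈S)
path-exit {S = S} (stepF {w = w} e p) u∈S v∉S with w ∈? S
... | yes w∈S = path-exit p w∈S v∉S
... | no w∉S = _ , w , u∈S , w∉S , inj₁ e
path-exit {S = S} (stepB {w = w} e p) u∈S v∉S with w ∈? S
... | yes w∈S = path-exit p w∈S v∉S
... | no w∉S = _ , w , u∈S , w∉S , inj₂ e

connected-mono : (∀ {f} → f ∈ₗ F → Inside S f → f ∈ₗ G) → Connected F S → Connected G S
connected-mono {F = F} {S = S} {G = G} F⊆G conn u v u∈S v∈S = path-mono lift (conn u v u∈S v∈S)
  where
  lift : ∀ {f} → f ∈ₗ restrict F S → f ∈ₗ restrict G S
  lift f∈ with ∈-restrict⁻ {F = F} f∈
  ... | f∈F , f∈S = ∈-restrict⁺ (F⊆G f∈F f∈S) f∈S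

connected-∪ : Connected T A → Connected T B → c ∈ₗ T → Cross A B c → Connected T (A ∪ B)
connected-∪ {T = T} {A = A} {B = B} {c = a , b} connA connB c∈T cross u v u∈ v∈ =
  join (x∈p∪q⁻ A B u∈) (x∈p∪q⁻ A B v∈)
  where
  liftˡ : ∀ {x y} → Path (restrict T A) x y → Path (restrict T (A ∪ B)) x y
  liftˡ = path-mono (restrict-⊆ {A = A} {F = T} (p⊆p∪q B))
  liftʳ : ∀ {x y} → Path (restrict T B) x y → Path (restrict T (A ∪ B)) x y
  liftʳ = path-mono (restrict-⊆ {A = B} {F = T} (q⊆p∪q A B))
  c∈ : (a , b) ∈ₗ restrict T (A ∪ B)
  c∈ = ∈-restrict⁺ c∈T (cross⇒inside-∪ cross)
  bridge : Cross A B (a , b) → ∀ {x y} → x ∈ A → y ∈ B → Path (restrict T (A ∪ B)) x y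
  bridge (inj₁ (a∈A , b∈B)) {x} {y} x∈A y∈B =
    path-++ (liftˡ (connA x a x∈A a∈A)) (stepF c∈ (liftʳ (connB b y b∈B y∈B)))
  bridge (inj₂ (a∈B , b∈A)) {x} {y} x∈A y∈B =
    path-++ (liftˡ (connA x b x∈A b∈A)) (stepB c∈ (liftʳ (connB a y a∈B y∈B)))
  join : u ∈ A ⊎ u ∈ B → v ∈ A ⊎ v ∈ B → Path (restrict T (A ∪ B)) u v
  join (inj₁ u∈A) (inj₁ v∈A) = liftˡ (connA u v u∈A v∈A)
  join (inj₁ u∈A) (inj₂ v∈B) = bridge cross u∈A v∈B
  join (inj₂ u∈B) (inj₁ v∈A) = path-reverse (bridge cross v∈A u∈B)
  join (inj₂ u∈B) (inj₂ v∈B) = liftʳ (connB u v u∈B v∈B)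

connected-⁅⁆ : ∀ (w : Fin n) → Connected F ⁅ w ⁆
connected-⁅⁆ w u v u∈ v∈ rewrite x∈⁅y⁆⇒x≡y w u∈ | x∈⁅y⁆⇒x≡y w v∈ = here

disjoint-tail : ∀ {x y} → Disjoint {suc n} (x ∷ A) (y ∷ B) → Disjoint A B
disjoint-tail x∷A#y∷B v (v∈A , v∈B) = x∷A#y∷B (suc v) (there v∈A , there v∈B)

∣p∪q∣≡∣p∣+∣q∣ : ∀ (A B : Subset n) → Disjoint A B → # (A ∪ B) ≡ # A ℕ.+ # B
∣p∪q∣≡∣p∣+∣q∣ [] [] _ = refl
∣p∪q∣≡∣p∣+∣q∣ (inside ∷ A) (inside ∷ B) A#B = ⊥-elim (A#B zero (here , here))
∣p∪q∣≡∣p∣+∣q∣ (inside ∷ A) (outside ∷ B) A#B = cong suc (∣p∪q∣≡∣p∣+∣q∣ A B (disjoint-tail A#B))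
∣p∪q∣≡∣p∣+∣q∣ (outside ∷ A) (inside ∷ B) A#B =
  trans (cong suc (∣p∪q∣≡∣p∣+∣q∣ A B (disjoint-tail A#B))) (sym (ℕ.+-suc (# A) (# B)))
∣p∪q∣≡∣p∣+∣q∣ (outside ∷ A) (outside ∷ B) A#B = ∣p∪q∣≡∣p∣+∣q∣ A B (disjoint-tail A#B)

popS-∪ : ∀ (pop : Fin n → ℚ) A B → Disjoint A B → popS pop (A ∪ B) ≡ popS pop A + popS pop B
popS-∪ pop [] [] _ = refl
popS-∪ pop (inside ∷ A) (inside ∷ B) A#B = ⊥-elim (A#B zero (here , here))
popS-∪ pop (inside ∷ A) (outside ∷ B) A#B rewrite popS-∪ (pop ∘ suc) A B (disjoint-tail A#B) =
  solve 3 (λ x a b → x :+ (a :+ b) := (x :+ a) :+ (con 0ℚ :+ b)) refl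
        (pop zero) (popS (pop ∘ suc) A) (popS (pop ∘ suc) B)
  where open +-*-Solver
popS-∪ pop (outside ∷ A) (inside ∷ B) A#B rewrite popS-∪ (pop ∘ suc) A B (disjoint-tail A#B) =
  solve 3 (λ x a b → x :+ (a :+ b) := (con 0ℚ :+ a) :+ (x :+ b)) refl
        (pop zero) (popS (pop ∘ suc) A) (popS (pop ∘ suc) B)
  where open +-*-Solver
popS-∪ pop (outside ∷ A) (outside ∷ B) A#B rewrite popS-∪ (pop ∘ suc) A B (disjoint-tail A#B) =
  solve 2 (λ a b → con 0ℚ :+ (a :+ b) := (con 0ℚ :+ a) :+ (con 0ℚ :+ b)) refl
        (popS (pop ∘ suc) A) (popS (pop ∘ suc) B)
  where open +-*-Solver

isSpanningTree⇒connected : IsSpanningTree F S T → Connected T S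
isSpanningTree⇒connected (_ , _ , connected , _) = connected

isSpanningTree⇒1≤∣S∣ : IsSpanningTree F S T → 1 ℕ.≤ # S
isSpanningTree⇒1≤∣S∣ (_ , _ , _ , size) = subst (1 ℕ.≤_) size (s≤s z≤n)

isSpanningTree-⁅⁆ : ∀ (b : Fin n) → IsSpanningTree F ⁅ b ⁆ []
isSpanningTree-⁅⁆ b = [] , [] , connected-⁅⁆ {F = []} b , sym (∣⁅x⁆∣≡1 b)

isSpanningTree-∪ : ∀ {TA TB} → IsSpanningTree F A TA → IsSpanningTree F B TB → Disjoint A B →
                   c ∈ₗ F → Cross A B c → IsSpanningTree F (A ∪ B) (c ∷ TA ++ TB)
isSpanningTree-∪ {F = F} {A = A} {B = B} {c = c} {TA} {TB}
                 (TA⊆F , uniqueA , connA , sizeA) (TB⊆F , uniqueB , connB , sizeB) A#B c∈F cross =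
  edges , (All.tabulate c-fresh ∷ Unique.++⁺ uniqueA uniqueB separate) , connected , size
  where
  insideA : ∀ {f} → f ∈ₗ TA → Inside A f
  insideA f∈ = proj₂ (∈-restrict⁻ {F = F} (All.lookup TA⊆F f∈))
  insideB : ∀ {f} → f ∈ₗ TB → Inside B f
  insideB f∈ = proj₂ (∈-restrict⁻ {F = F} (All.lookup TB⊆F f∈))

  edges : All (_∈ₗ restrict F (A ∪ B)) (c ∷ TA ++ TB)
  edges = ∈-restrict⁺ c∈F (cross⇒inside-∪ cross)
        ∷ All.++⁺ (All.map (restrict-⊆ {A = A} {F = F} (p⊆p∪q B)) TA⊆F)
                  (All.map (restrict-⊆ {A = B} {F = F} (q⊆p∪q A B)) TB⊆F)

  c-fresh : ∀ {f} → f ∈ₗ TA ++ TB → c ≢ f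
  c-fresh f∈ refl with ∈-++⁻ TA f∈
  ... | inj₁ c∈TA = cross⇒¬insideˡ A#B cross (insideA c∈TA)
  ... | inj₂ c∈TB = cross⇒¬insideʳ A#B cross (insideB c∈TB)

  separate : ∀ {f} → ¬ (f ∈ₗ TA × f ∈ₗ TB)
  separate (f∈TA , f∈TB) = A#B _ (proj₁ (insideA f∈TA) , proj₁ (insideB f∈TB))

  connected : Connected (c ∷ TA ++ TB) (A ∪ B)
  connected = connected-∪ (connected-mono {F = TA} (λ f∈ _ → there (∈-++⁺ˡ f∈)) connA)
                          (connected-mono {F = TB} (λ f∈ _ → there (∈-++⁺ʳ TA f∈)) connB)
                          (here refl) cross

  size : suc (length (c ∷ TA ++ TB)) ≡ # (A ∪ B)
  size = begin
    suc (suc (length (TA ++ TB)))           ≡⟨ cong (ℕ.suc ∘ ℕ.suc) (length-++ TA {TB}) ⟩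
    suc (suc (length TA ℕ.+ length TB))     ≡⟨ cong suc (ℕ.+-suc (length TA) (length TB)) ⟨
    suc (length TA) ℕ.+ suc (length TB)     ≡⟨ cong₂ ℕ._+_ sizeA sizeB ⟩
    # A ℕ.+ # B                             ≡⟨ ∣p∪q∣≡∣p∣+∣q∣ A B A#B ⟨
    # (A ∪ B)                               ∎
    where open ≡-Reasoning

data Chain (T : List (Edge n)) : Subset n → List (Subset n) → Set where
  single : Connected T D → Chain T D [ D ]
  link   : Connected T D → Disjoint D U → c ∈ₗ T → Cross D U c →
           Chain T U L → Chain T (D ∪ U) (D ∷ L)

chain-length≥1 : Chain T U L → 1 ℕ.≤ length L
chain-length≥1 (single _) = s≤s z≤n
chain-length≥1 (link _ _ _ _ _) = s≤s z≤n

chain-mono : (∀ {f} → f ∈ₗ T → Inside U f → f ∈ₗ T′) → Chain T U L → Chain T′ U L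
chain-mono T⊆T′ (single connD) = single (connected-mono T⊆T′ connD)
chain-mono T⊆T′ (link {D = D} {U = U} connD D#U c∈T cross chain) =
  link (connected-mono (λ f∈ f∈D → T⊆T′ f∈ (inside-⊆ (p⊆p∪q U) f∈D)) connD)
       D#U (T⊆T′ c∈T (cross⇒inside-∪ cross)) cross
       (chain-mono (λ f∈ f∈U → T⊆T′ f∈ (inside-⊆ (q⊆p∪q D U) f∈U)) chain)

chain-removeEdge : ¬ Inside U c → Chain T U L → Chain (restrict (removeEdge T c) U) U L
chain-removeEdge c∉U = chain-mono λ f∈T f∈U → ∈-restrict⁺ (∈-removeEdge-inside c∉U f∈T f∈U) f∈U

chain⇒connected : Chain T U L → Connected T U
chain⇒connected (single connD) = connD
chain⇒connected (link connD _ c∈T cross chain) = connected-∪ connD (chain⇒connected chain) c∈T cross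

components-cut : Connected T D → Connected T U → Disjoint D U → Cross D U c →
                 Components T c (D ∪ U) D U
components-cut {T = T} {D = D} {U = U} connD connU D#U cross =
  (λ v → x∈p∪q⁻ D U , p⊆p∪q U , q⊆p∪q D U , D#U v) ,
  connected-mono {F = T} (∈-removeEdge-inside (cross⇒¬insideˡ D#U cross)) connD ,
  connected-mono {F = T} (∈-removeEdge-inside (cross⇒¬insideʳ D#U cross)) connU

ℕ→ℚ-+ : ∀ m n → ℕ→ℚ (m ℕ.+ n) ≡ ℕ→ℚ m + ℕ→ℚ n
ℕ→ℚ-+ m n = toℚᵘ-injective (begin
  toℚᵘ (ℕ→ℚ (m ℕ.+ n))                     ≈⟨ toℚᵘ-fromℚᵘ (ℚᵘ.mkℚᵘ (+ (m ℕ.+ n)) 0) ⟩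
  ℚᵘ.mkℚᵘ (+ (m ℕ.+ n)) 0                   ≈⟨ ℚᵘ.*≡* numerators ⟩
  ℚᵘ.mkℚᵘ (+ m) 0 ℚᵘ.+ ℚᵘ.mkℚᵘ (+ n) 0     ≈⟨ ℚᵘ.+-cong (toℚᵘ-fromℚᵘ (ℚᵘ.mkℚᵘ (+ m) 0))
                                                         (toℚᵘ-fromℚᵘ (ℚᵘ.mkℚᵘ (+ n) 0)) ⟨
  toℚᵘ (ℕ→ℚ m) ℚᵘ.+ toℚᵘ (ℕ→ℚ n)           ≈⟨ toℚᵘ-homo-+ (ℕ→ℚ m) (ℕ→ℚ n) ⟨
  toℚᵘ (ℕ→ℚ m + ℕ→ℚ n)                      ∎)
  where
  open ℚᵘ.≃-Reasoning
  numerators : + (m ℕ.+ n) ℤ.* + 1 ≡ (+ m ℤ.* + 1 ℤ.+ + n ℤ.* + 1) ℤ.* + 1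
  numerators = cong (ℤ._* + 1)
    (trans (ℤ.pos-+ m n) (sym (cong₂ ℤ._+_ (ℤ.*-identityʳ (+ m)) (ℤ.*-identityʳ (+ n)))))

∣x-a∣≤r : ∀ {x a r} → a - r ≤ x → x ≤ a + r → ∣ x - a ∣ ≤ r
∣x-a∣≤r {x} {a} {r} a-r≤x x≤a+r with ∣p∣≡p∨∣p∣≡-p (x - a)
... | inj₁ ∣x-a∣≡x-a = begin
  ∣ x - a ∣      ≡⟨ ∣x-a∣≡x-a ⟩
  x - a          ≤⟨ +-monoˡ-≤ (- a) x≤a+r ⟩
  (a + r) - a    ≡⟨ solve 2 (λ a r → (a :+ r) :- a := r) refl a r ⟩
  r              ∎
  where
    open ≤-Reasoning
    open +-*-Solver
... | inj₂ ∣x-a∣≡a-x = begin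
  ∣ x - a ∣      ≡⟨ ∣x-a∣≡a-x ⟩
  - (x - a)      ≡⟨ solve 2 (λ x a → :- (x :- a) := a :- x) refl x a ⟩
  a - x          ≤⟨ +-monoʳ-≤ a (neg-antimono-≤ a-r≤x) ⟩
  a - (a - r)    ≡⟨ solve 2 (λ a r → a :- (a :- r) := r) refl a r ⟩
  r              ∎
  where
    open ≤-Reasoning
    open +-*-Solver

∣x+y-[a+b]∣≤r+s : ∀ {x y a b r s} → ∣ x - a ∣ ≤ r → ∣ y - b ∣ ≤ s → ∣ (x + y) - (a + b) ∣ ≤ r + s
∣x+y-[a+b]∣≤r+s {x} {y} {a} {b} {r} {s} ∣x-a∣≤r ∣y-b∣≤s = begin
  ∣ (x + y) - (a + b) ∣   ≡⟨ cong ∣_∣ (solve 4 (λ x y a b → (x :+ y) :- (a :+ b) := (x :- a) :+ (y :- b))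
                                              refl x y a b) ⟩
  ∣ (x - a) + (y - b) ∣   ≤⟨ ∣p+q∣≤∣p∣+∣q∣ (x - a) (y - b) ⟩
  ∣ x - a ∣ + ∣ y - b ∣   ≤⟨ +-mono-≤ ∣x-a∣≤r ∣y-b∣≤s ⟩
  r + s                   ∎
  where
    open ≤-Reasoning
    open +-*-Solver

module _ {n} (pop : Fin n → ℚ) (I ε : ℚ) where

  WithinTolerance : Subset n → ℕ → Set
  WithinTolerance D m = ∣ popS pop D - ℕ→ℚ m * I ∣ ≤ (ℕ→ℚ m * ε) * I

  withinTolerance-1 : ∀ {D} → (1ℚ - ε) * I < popS pop D → popS pop D < (1ℚ + ε) * I →
                      WithinTolerance D 1
  withinTolerance-1 {D} lower upper = ∣x-a∣≤r
    (begin
      1ℚ * I - (1ℚ * ε) * I    ≡⟨ solve 2 (λ ε I → con 1ℚ :* I :- (con 1ℚ :* ε) :* I := (con 1ℚ :- ε) :* I)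
                                          refl ε I ⟩
      (1ℚ - ε) * I             <⟨ lower ⟩
      popS pop D               ∎)
    (begin
      popS pop D               <⟨ upper ⟩
      (1ℚ + ε) * I             ≡⟨ solve 2 (λ ε I → (con 1ℚ :+ ε) :* I := con 1ℚ :* I :+ (con 1ℚ :* ε) :* I)
                                          refl ε I ⟩
      1ℚ * I + (1ℚ * ε) * I    ∎)
    where
      open ≤-Reasoning
      open +-*-Solver

  withinTolerance-∪ : ∀ {A B} m₁ m₂ → Disjoint A B →
                      WithinTolerance A m₁ → WithinTolerance B m₂ → WithinTolerance (A ∪ B) (m₁ ℕ.+ m₂)
  withinTolerance-∪ {A} {B} m₁ m₂ A#B withinA withinB = begin
    ∣ popS pop (A ∪ B) - ℕ→ℚ (m₁ ℕ.+ m₂) * I ∣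
      ≡⟨ cong₂ (λ p M → ∣ p - M * I ∣) (popS-∪ pop A B A#B) (ℕ→ℚ-+ m₁ m₂) ⟩
    ∣ (popS pop A + popS pop B) - (M₁ + M₂) * I ∣
      ≡⟨ cong (λ q → ∣ (popS pop A + popS pop B) - q ∣) (*-distribʳ-+ I M₁ M₂) ⟩
    ∣ (popS pop A + popS pop B) - (M₁ * I + M₂ * I) ∣
      ≤⟨ ∣x+y-[a+b]∣≤r+s {popS pop A} {popS pop B} {M₁ * I} {M₂ * I} withinA withinB ⟩
    (M₁ * ε) * I + (M₂ * ε) * I
      ≡⟨ solve 4 (λ a b ε I → (a :* ε) :* I :+ (b :* ε) :* I := ((a :+ b) :* ε) :* I) refl M₁ M₂ ε I ⟩
    ((M₁ + M₂) * ε) * I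
      ≡⟨ cong (λ M → (M * ε) * I) (ℕ→ℚ-+ m₁ m₂) ⟨
    (ℕ→ℚ (m₁ ℕ.+ m₂) * ε) * I
      ∎
    where
    open ≤-Reasoning
    open +-*-Solver
    M₁ = ℕ→ℚ m₁
    M₂ = ℕ→ℚ m₂

  chain⇒withinTolerance : Chain T U L → All (λ D → WithinTolerance D 1) L → WithinTolerance U (length L)
  chain⇒withinTolerance (single _) (withinD ∷ []) = withinD
  chain⇒withinTolerance (link {L = L} _ D#U _ _ chain) (withinD ∷ within) =
    withinTolerance-∪ 1 (length L) D#U withinD (chain⇒withinTolerance chain within)

  generatePlan-chain : (E : List (Edge n)) → Chain T U L → All (λ D → WithinTolerance D 1) L →
                       ∃ λ Q → GenPlan E pop I ε U T (length L) Q × Q ↭ L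
  generatePlan-chain E (single {D = D} _) _ = [ D ] , base , ↭-refl
  generatePlan-chain {T = T} E (link {D = D} {U = U} {c = c} {L = L} connD D#U c∈T cross chain)
                     (withinD ∷ within)
    with generatePlan-chain E (chain-removeEdge (cross⇒¬insideʳ D#U cross) chain) within
  ... | Q , run , Q↭L = D ∷ Q , split (s≤s (chain-length≥1 chain)) triple base run , prep D Q↭L
    where
    triple : ValidTriple pop I ε (D ∪ U) T (suc (length L)) c 1 (length L) D U
    triple = record
      { e∈T   = c∈T
      ; k₁≥1  = s≤s z≤n
      ; k₂≥1  = chain-length≥1 chain
      ; sum   = refl
      ; comps = components-cut {T = T} connD (chain⇒connected chain) D#U cross
      ; tol₁  = withinD
      ; tol₂  = chain⇒withinTolerance chain within
      }

-- Pool U L is the bookkeeping a particular use of the growth carries along: nothing for a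
-- plain spanning tree, the districts not yet used for a plan.
module Growth {n} (F : List (Edge n)) (S : Subset n) (connected : Connected F S)
              (Pool : Subset n → List (Subset n) → Set) where

  record Extension (U : Subset n) (L : List (Subset n)) (b : Fin n) : Set where
    field
      block    : Subset n
      tree     : List (Edge n)
      b∈block  : b ∈ block
      block⊆S  : block ⊆ S
      fresh    : Disjoint block U
      spanning : IsSpanningTree F block tree
      pool     : Pool (block ∪ U) (block ∷ L)

  record Grown (U : Subset n) (L : List (Subset n)) (T : List (Edge n)) : Set where
    field
      spanning : IsSpanningTree F U T
      chain    : Chain T U L
      U⊆S      : U ⊆ S
      pool     : Pool U L
      root     : Nonempty U

  Result : Set
  Result = ∃₂ λ L T → IsSpanningTree F S T × Chain T S L × Pool S L

  module _ (next : ∀ {U L b} → Pool U L → b ∈ S → b ∉ U → Extension U L b) where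

    extend : ∀ {U L T b c} → Grown U L T → (x : Extension U L b) →
             c ∈ₗ F → Cross (Extension.block x) U c →
             Grown (Extension.block x ∪ U) (Extension.block x ∷ L) (c ∷ Extension.tree x ++ T)
    extend {U} g x c∈F cross = record
      { spanning = isSpanningTree-∪ x.spanning g.spanning x.fresh c∈F cross
      ; chain    = link (connected-mono {F = x.tree} (λ f∈ _ → there (∈-++⁺ˡ f∈))
                                        (isSpanningTree⇒connected {F = F} x.spanning))
                        x.fresh (here refl) cross
                        (chain-mono (λ f∈ _ → there (∈-++⁺ʳ x.tree f∈)) g.chain)
      ; U⊆S      = Sum.[ x.block⊆S , g.U⊆S ] ∘′ x∈p∪q⁻ x.block U
      ; pool     = x.pool
      ; root     = let u , u∈U = g.root in u , x∈p∪q⁺ (inj₂ u∈U)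
      }
      where
      module g = Grown g
      module x = Extension x

    grow-step : ∀ {U L T b} → Grown U L T → b ∈ S → b ∉ U →
                ∃ λ U′ → ∃₂ λ L′ T′ → Grown U′ L′ T′ × # U ℕ.< # U′
    grow-step {U} g b∈S b∉U =
      let u , u∈U = g.root
          x , w , x∈U , w∉U , x~w = path-exit (connected u _ (g.U⊆S u∈U) b∈S) u∈U b∉U
          x~w∈F , w∈S = adjacent-restrict⁻ {F = F} x~w
          ext = next g.pool w∈S w∉U
          c , c∈F , cross = adjacent⇒cross x~w∈F x∈U (Extension.b∈block ext)
      in _ , _ , _ , extend g ext c∈F cross , grows ext
      where
      module g = Grown g
      grows : ∀ {L w} (x : Extension U L w) → # U ℕ.< # (Extension.block x ∪ U)
      grows x = begin-strict
        # U                   <⟨ ℕ.n<1+n (# U) ⟩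
        1 ℕ.+ # U             ≤⟨ ℕ.+-monoˡ-≤ (# U) (isSpanningTree⇒1≤∣S∣ {F = F} x.spanning) ⟩
        # x.block ℕ.+ # U     ≡⟨ ∣p∪q∣≡∣p∣+∣q∣ x.block U x.fresh ⟨
        # (x.block ∪ U)       ∎
        where
        open ℕ.≤-Reasoning
        module x = Extension x

    finish : ∀ {U L T} → Grown U L T → S ⊆ U → Result
    finish {L = L} {T} g S⊆U with refl ← ⊆-antisym (Grown.U⊆S g) S⊆U =
      L , T , Grown.spanning g , Grown.chain g , Grown.pool g

    grow : ∀ fuel {U L T} → n ℕ.< # U ℕ.+ fuel → Grown U L T → Result
    grow zero {U} bound _ = ⊥-elim (ℕ.<⇒≱ (subst (n ℕ.<_) (ℕ.+-identityʳ (# U)) bound) (∣p∣≤n U))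
    grow (suc fuel) {U} bound g with any? (λ v → v ∈? S ×-dec ¬? (v ∈? U))
    ... | yes (b , b∈S , b∉U) =
      let U′ , _ , _ , g′ , U<U′ = grow-step g b∈S b∉U
          bound′ = ℕ.≤-trans (ℕ.≤-reflexive (ℕ.+-suc (# U) fuel)) (ℕ.+-monoˡ-≤ fuel U<U′)
      in grow fuel (ℕ.<-≤-trans bound bound′) g′
    ... | no nothing-left =
      finish g λ {v} v∈S → decidable-stable (v ∈? U) λ v∉U → nothing-left (v , v∈S , v∉U)

    spanningChain : ∀ {b} → b ∈ S → Pool ∅ [] → Result
    spanningChain {b} b∈S pool = grow (suc n) bound record
      { spanning = x.spanning
      ; chain    = single (isSpanningTree⇒connected {F = F} x.spanning)
      ; U⊆S      = x.block⊆S
      ; pool     = subst (λ U → Pool U [ x.block ]) (∪-identityʳ x.block) x.pool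
      ; root     = b , x.b∈block
      }
      where
      module x = Extension (next pool b∈S ∉⊥)
      bound : n ℕ.< # x.block ℕ.+ suc n
      bound = ℕ.<-≤-trans (ℕ.n<1+n n) (ℕ.m≤n+m (suc n) (# x.block))

connected⇒spanningTree : Connected F S → Nonempty S → ∃ (IsSpanningTree F S)
connected⇒spanningTree {F = F} {S = S} connected (b , b∈S) =
  let _ , T , spanning , _ = spanningChain singleton b∈S tt in T , spanning
  where
  open Growth F S connected (λ _ _ → 𝟙)
  singleton : ∀ {U L b} → 𝟙 → b ∈ S → b ∉ U → Extension U L b
  singleton {U} {b = b} _ b∈S b∉U = record
    { block    = ⁅ b ⁆
    ; tree     = []
    ; b∈block  = x∈⁅x⁆ b
    ; block⊆S  = λ v∈⁅b⁆ → subst (_∈ S) (sym (x∈⁅y⁆⇒x≡y b v∈⁅b⁆)) b∈S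
    ; fresh    = λ v (v∈⁅b⁆ , v∈U) → b∉U (subst (_∈ U) (x∈⁅y⁆⇒x≡y b v∈⁅b⁆) v∈U)
    ; spanning = isSpanningTree-⁅⁆ {F = F} b
    ; pool     = tt
    }

pick : ∀ {X : Set} {R : X → X → Set} {P Q : X → Set} {xs} → Symmetric R →
       Any P xs → All Q xs → AllPairs R xs →
       ∃₂ λ x ys → x ∷ ys ↭ xs × P x × Q x × All Q ys × AllPairs R ys × All (R x) ys
pick R-sym (here px) (qx ∷ qxs) (Rx ∷ Rxs) = _ , _ , ↭-refl , px , qx , qxs , Rxs , Rx
pick R-sym (there {x = x} p) (qx ∷ qxs) (Rx ∷ Rxs) with pick R-sym p qxs Rxs
... | y , ys , y∷ys↭xs , py , qy , qys , Rys , Ry with All-resp-↭ (↭-sym y∷ys↭xs) Rx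
...   | Rxy ∷ Rxys = y , x ∷ ys , ↭-trans (swap y x ↭-refl) (prep x y∷ys↭xs) ,
                     py , qy , qx ∷ qys , Rxys ∷ Rys , R-sym Rxy ∷ Ry

module _ {n} (E : List (Edge n)) (connected : Connected E ⊤) {P : List (Subset n)}
         (disjoint : AllPairs Disjoint P) (covers : ∀ v → Any (v ∈_) P)
         (districts : All (λ D → Nonempty D × Connected E D) P) where

  record Remaining (U : Subset n) (L : List (Subset n)) : Set where
    field
      rest       : List (Subset n)
      L++rest↭P  : L ++ rest ↭ P
      pairwise   : AllPairs Disjoint rest
      candidates : All (λ B → Disjoint B U × Nonempty B × Connected E B) rest
      used       : All (_⊆ U) L

  open Growth E ⊤ connected Remaining

  nextDistrict : ∀ {U L b} → Remaining U L → b ∈ ⊤ → b ∉ U → Extension U L b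
  nextDistrict {U} {L} {b} remaining _ b∉U
    with ++⁻ L (Any-resp-↭ (↭-sym (Remaining.L++rest↭P remaining)) (covers b))
  ... | inj₁ b∈L =
    let D⊆U , b∈D = All.lookupAny (Remaining.used remaining) b∈L in ⊥-elim (b∉U (D⊆U b∈D))
  ... | inj₂ b∈rest
    with pick disjoint-sym b∈rest (Remaining.candidates remaining) (Remaining.pairwise remaining)
  ...   | D , rest′ , D∷rest′↭rest , b∈D , (D#U , _ , connD) , candidates , pairwise′ , D#rest′ = record
    { block    = D
    ; tree     = proj₁ tree
    ; b∈block  = b∈D
    ; block⊆S  = λ _ → ∈⊤
    ; fresh    = D#U
    ; spanning = proj₂ tree
    ; pool     = record
      { rest       = rest′
      ; L++rest↭P  = ↭-trans (↭-sym (shift D L rest′))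
                       (↭-trans (++⁺ˡ L D∷rest′↭rest) (Remaining.L++rest↭P remaining))
      ; pairwise   = pairwise′
      ; candidates = All.zipWith
                       (λ (D#B , B#U , district) → disjoint-∪ (disjoint-sym D#B) B#U , district)
                       (D#rest′ , candidates)
      ; used       = p⊆p∪q U
                     ∷ All.map (λ D′⊆U {v} v∈D′ → q⊆p∪q D U (D′⊆U v∈D′)) (Remaining.used remaining)
      }
    }
    where tree = connected⇒spanningTree {F = E} connD (b , b∈D)

  partitionSpanningTree : Fin n → ∃₂ λ L T → L ↭ P × IsSpanningTree E ⊤ T × Chain T ⊤ L
  partitionSpanningTree v₀ =
    let L , T , spanning , chain , remaining = spanningChain nextDistrict (∈⊤ {x = v₀}) initial
    in L , T , exhausted remaining , spanning , chain
    where
    initial : Remaining ∅ []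
    initial = record
      { rest       = P
      ; L++rest↭P  = ↭-refl
      ; pairwise   = disjoint
      ; candidates = All.map (λ district → (λ v (_ , v∈∅) → ∉⊥ v∈∅) , district) districts
      ; used       = []
      }
    exhausted : ∀ {L} → Remaining ⊤ L → L ↭ P
    exhausted {L} record { rest = [] ; L++rest↭P = L++[]↭P } =
      subst (_↭ P) (++-identityʳ L) L++[]↭P
    exhausted record { rest = _ ∷ _ ; candidates = (B#⊤ , (w , w∈B) , _) ∷ _ } =
      ⊥-elim (B#⊤ w (w∈B , ∈⊤))

proposition2 : (n : ℕ) (E : List (Edge n)) (pop : Fin n → ℚ) →
    (∀ v → Positive (pop v)) → Connected E ⊤ →
    (k : ℕ) → .{{_ : NonZero k}} → (ε : ℚ) → Positive ε →
    (P : List (Subset n)) → ValidPlan E pop k ε P → BonsaiOutputs E pop k ε P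
proposition2 n E pop _ connected k ε _ [] (length≡k , _) = ⊥-elim (ℕ.≢-nonZero⁻¹ k (sym length≡k))
proposition2 n E pop _ connected k ε _ P@(_ ∷ _)
             (length≡k , disjoint , covers , districts@(((v₀ , _) , _) ∷ _)) =
  let L , T , L↭P , spanning , chain = partitionSpanningTree E connected disjoint covers blocks v₀
      Q , run , Q↭L = generatePlan-chain pop I ε E chain (All-resp-↭ (↭-sym L↭P) tolerances)
      length-L≡k = trans (↭-length L↭P) length≡k
  in T , Q , spanning , subst (λ m → GenPlan E pop I ε ⊤ T m Q) length-L≡k run , ↭-trans Q↭L L↭P
  where
  I = ideal pop k
  blocks : All (λ D → Nonempty D × Connected E D) P
  blocks = All.map (λ (nonempty , connD , _) → nonempty , connD) districts
  tolerances : All (λ D → WithinTolerance pop I ε D 1) P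
  tolerances = All.map (λ (_ , _ , lower , upper) → withinTolerance-1 pop I ε lower upper) districts
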